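{- Let $C$ be a non-ambiguous class of tree-like tableaux. Then $\sum_{T\in C}oc(T)=|C|$; that is, on average there is exactly one occupied corner per tree-like tableau in $C$.
   Context: A tree-like tableau is a filling of a Young diagram (English convention) in which some cells contain a point, subject to: (1) the top-left cell contains a point; (2) for each other point, there is a point above it in the same column or a point to its left in the same row, but not both; (3) there is no empty row and no empty column. A non-ambiguous class is a maximal set of tree-like tableaux whose points are arranged in the same way, i.e. which have exactly the same set of point positions (row index counted from the top, column index counted from the left), while their underlying Young diagram shapes may differ. A corner is a cell whose bottom and right edges both lie on the Southeast boundary of the diagram; it is occupied if it contains a point; $oc(T)$ is the number of occupied corners of $T$. -}

module Defs where

open import Data.Bool using (Bool; true; false; _∧_; not; if_then_else_)
open import Data.Nat using (ℕ; zero; suc; _+_; _≤_; _<_)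
open import Data.List using (List; []; _∷_; length; map; upTo)
open import Data.Nat.ListAction using (sum)
open import Data.Product using (Σ; _×_; _,_; ∃)
open import Data.Sum using (_⊎_)
open import Relation.Nullary using (¬_)
open import Relation.Binary.PropositionalEquality using (_≡_; _≢_)
open import Data.List.Membership.Propositional using (_∈_)
open import Data.List.Relation.Unary.Unique.Propositional using (Unique)
open import Function.Bundles using (_⇔_)

-- A filled Young diagram (English convention): the list of rows, from top
-- to bottom; row i is the list of its cells from left to right; an entry
-- is `true` iff the cell contains a point.  Row index i and column index j
-- are counted from 0 (top row, leftmost column).
Tableau : Set
Tableau = List (List Bool)

rowAt : Tableau → ℕ → List Bool
rowAt []       _       = []
rowAt (r ∷ rs) zero    = r
rowAt (r ∷ rs) (suc i) = rowAt rs i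

inRow : List Bool → ℕ → Bool
inRow []       _       = false
inRow (b ∷ bs) zero    = true
inRow (b ∷ bs) (suc j) = inRow bs j

ptRow : List Bool → ℕ → Bool
ptRow []       _       = false
ptRow (b ∷ bs) zero    = b
ptRow (b ∷ bs) (suc j) = ptRow bs j

inD : Tableau → ℕ → ℕ → Bool
inD T i j = inRow (rowAt T i) j

pt : Tableau → ℕ → ℕ → Bool
pt T i j = ptRow (rowAt T i) j

IsYoung : Tableau → Set
IsYoung T = ∀ i → length (rowAt T (suc i)) ≤ length (rowAt T i)

PointAbove : Tableau → ℕ → ℕ → Set
PointAbove T i j = Σ ℕ λ i' → i' < i × pt T i' j ≡ true

PointLeft : Tableau → ℕ → ℕ → Set
PointLeft T i j = Σ ℕ λ j' → j' < j × pt T i j' ≡ true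

record TreeLike (T : Tableau) : Set where
  field
    young    : IsYoung T
    topLeft  : pt T 0 0 ≡ true
    treeRule : ∀ i j → pt T i j ≡ true → ¬ (i ≡ 0 × j ≡ 0) →
               (PointAbove T i j ⊎ PointLeft T i j)
               × ¬ (PointAbove T i j × PointLeft T i j)
    noEmptyRow : ∀ i → i < length T → ∃ λ j → pt T i j ≡ true
    noEmptyCol : ∀ j → inD T 0 j ≡ true → ∃ λ i → pt T i j ≡ true

SamePoints : Tableau → Tableau → Set
SamePoints T T' = ∀ i j → pt T i j ≡ pt T' i j

isCorner : Tableau → ℕ → ℕ → Bool
isCorner T i j = inD T i j ∧ not (inD T (suc i) j) ∧ not (inD T i (suc j))

width : Tableau → ℕ
width T = length (rowAt T 0)

oc : Tableau → ℕ
oc T = sum (map (λ i → sum (map (λ j → if isCorner T i j ∧ pt T i j then 1 else 0)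
                                  (upTo (width T))))
                (upTo (length T)))

IsNonAmbiguousClass : List Tableau → Set
IsNonAmbiguousClass C =
  Unique C × (Σ Tableau λ T₀ → TreeLike T₀ ×
                (∀ T → (T ∈ C) ⇔ (TreeLike T × SamePoints T T₀)))

-- A tableau with the same points as T₀ is determined by its shape, the list μ of its row lengths,
-- and it is tree-like exactly when μ is a partition with first part c = width T₀ and μᵢ > pᵢ, where
-- pᵢ is the column of the last point in row i of T₀.  Row i then ends in an occupied corner iff
-- μᵢ = pᵢ + 1 and μᵢ₊₁ < μᵢ.  By induction on the number of rows, the occupied corners of all such
-- shapes with first part at most b are exactly as many as the shapes with first part equal to b.
-- As column c − 1 of T₀ contains a point, no admissible shape has first part below c, so the class
-- carries exactly as many occupied corners as it has members.
module Submission where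

open import Defs
open import Data.Bool using (Bool; true; false; _∧_; _∨_; not; if_then_else_)
open import Data.Bool.ListAction using (or)
open import Data.Bool.Properties using (∧-zeroʳ; ∧-identityʳ; ∧-comm; ∨-zeroʳ; ∨-identityʳ; ¬-not)
open import Data.Empty using (⊥-elim)
open import Data.List using (List; []; _∷_; _++_; map; length; upTo; applyUpTo)
open import Data.List.Properties
  using (length-map; length-++; length-applyUpTo; map-++; map-∘; map-cong; map-cong-local; map-upTo;
         ∷-injectiveʳ)
open import Data.List.Membership.Propositional using (_∈_; _∉_)
open import Data.List.Membership.Propositional.Properties
  using (∈-map⁺; ∈-map⁻; ∈-++⁺ˡ; ∈-++⁺ʳ; ∈-++⁻)
open import Data.List.Membership.Propositional.Properties.WithK using (unique∧set⇒bag)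
open import Data.List.Relation.Binary.BagAndSetEquality using (∼bag⇒↭)
open import Data.List.Relation.Binary.Permutation.Propositional using (_↭_)
import Data.List.Relation.Binary.Permutation.Propositional.Properties as ↭
open import Data.List.Relation.Unary.All as All using ([])
open import Data.List.Relation.Unary.AllPairs using ([]; _∷_)
open import Data.List.Relation.Unary.Any using (here; there)
open import Data.List.Relation.Unary.Unique.Propositional using (Unique)
import Data.List.Relation.Unary.Unique.Propositional.Properties as Unique
open import Data.Nat using (ℕ; zero; suc; pred; _+_; _*_; _≤_; _<_; z≤n; s≤s; s≤s⁻¹)
open import Data.Nat.ListAction using (sum)
open import Data.Nat.ListAction.Properties using (sum-++; sum-↭)
open import Data.Nat.Properties
open import Algebra.Properties.CommutativeSemigroup +-commutativeSemigroup using (interchange)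
open import Data.Product using (∃; _×_; _,_; proj₁; proj₂; map₂)
open import Data.Sum as Sum using (inj₁; inj₂)
open import Function using (_∘_)
open import Function.Bundles using (_⇔_; Equivalence; mk⇔)
open import Relation.Binary.Definitions using (tri<; tri≈; tri>)
open import Relation.Binary.PropositionalEquality
open import Relation.Nullary using (Dec; does; yes; no)
open import Relation.Nullary.Decidable using (dec-true; dec-false)

sum-map-+ : ∀ {A : Set} (f g : A → ℕ) (xs : List A) →
            sum (map (λ x → f x + g x) xs) ≡ sum (map f xs) + sum (map g xs)
sum-map-+ f g []       = refl
sum-map-+ f g (x ∷ xs) =
  trans (cong (f x + g x +_) (sum-map-+ f g xs)) (interchange (f x) (g x) _ _)

sum-map-constant : ∀ {A : Set} {f : A → ℕ} {k : ℕ} (xs : List A) →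
                   (∀ {x} → x ∈ xs → f x ≡ k) → sum (map f xs) ≡ length xs * k
sum-map-constant []       _   = refl
sum-map-constant (x ∷ xs) f≡k = cong₂ _+_ (f≡k (here refl)) (sum-map-constant xs (f≡k ∘ there))

sum-applyUpTo-zero : ∀ (h : ℕ → ℕ) n → (∀ j → h j ≡ 0) → sum (applyUpTo h n) ≡ 0
sum-applyUpTo-zero h zero    h≡0 = refl
sum-applyUpTo-zero h (suc n) h≡0 = cong₂ _+_ (h≡0 0) (sum-applyUpTo-zero (h ∘ suc) n (h≡0 ∘ suc))

sum-applyUpTo-single : ∀ (h : ℕ → ℕ) {n k} → k < n → (∀ j → j ≢ k → h j ≡ 0) →
                       sum (applyUpTo h n) ≡ h k
sum-applyUpTo-single h {suc n} {zero}  _         h≡0 =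
  trans (cong (h 0 +_) (sum-applyUpTo-zero (h ∘ suc) n (λ j → h≡0 (suc j) λ ()))) (+-identityʳ (h 0))
sum-applyUpTo-single h {suc n} {suc k} (s≤s k<n) h≡0 =
  cong₂ _+_ (h≡0 0 λ ())
            (sum-applyUpTo-single (h ∘ suc) k<n (λ j j≢k → h≡0 (suc j) (j≢k ∘ suc-injective)))

applyUpTo-cong : ∀ {A : Set} {f g : ℕ → A} n → (∀ j → f j ≡ g j) → applyUpTo f n ≡ applyUpTo g n
applyUpTo-cong zero    f≗g = refl
applyUpTo-cong (suc n) f≗g = cong₂ _∷_ (f≗g 0) (applyUpTo-cong n (f≗g ∘ suc))

all∉⇒≡[] : ∀ {A : Set} {xs : List A} → (∀ {x} → x ∉ xs) → xs ≡ []
all∉⇒≡[] {xs = []}    _   = refl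
all∉⇒≡[] {xs = x ∷ _} x∉ = ⊥-elim (x∉ (here refl))

not-<? : ∀ m n → not (does (m <? n)) ≡ does (n <? suc m)
not-<? zero    zero    = refl
not-<? zero    (suc n) = refl
not-<? (suc m) zero    = refl
not-<? (suc m) (suc n) = not-<? m n

-- Admissible shapes and their occupied corners

firstPart : List ℕ → ℕ
firstPart []      = 0
firstPart (a ∷ _) = a

-- A shape is the list μ of the row lengths of a Young diagram; pᵢ is the column of the last point
-- of row i, which μᵢ must exceed.
data Admissible : List ℕ → List ℕ → Set where
  []  : Admissible [] []
  _∷_ : ∀ {p ps a μ} → p < a × firstPart μ ≤ a → Admissible ps μ → Admissible (p ∷ ps) (a ∷ μ)

mutual
  shapes : List ℕ → ℕ → List (List ℕ)
  shapes []       b       = [] ∷ []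
  shapes (p ∷ ps) zero    = []
  shapes (p ∷ ps) (suc b) = shapes (p ∷ ps) b ++ shapesOfWidth (p ∷ ps) (suc b)

  shapesOfWidth : List ℕ → ℕ → List (List ℕ)
  shapesOfWidth []       a = []
  shapesOfWidth (p ∷ ps) a with p <? a
  ... | yes _ = map (a ∷_) (shapes ps a)
  ... | no  _ = []

shapesOfWidth-< : ∀ {p ps a} → p < a → shapesOfWidth (p ∷ ps) a ≡ map (a ∷_) (shapes ps a)
shapesOfWidth-< {p} {a = a} p<a with p <? a
... | yes _   = refl
... | no p≮a = ⊥-elim (p≮a p<a)

shapesOfWidth-≤ : ∀ {p ps a} → a ≤ p → shapesOfWidth (p ∷ ps) a ≡ []
shapesOfWidth-≤ {p} {a = a} a≤p with p <? a
... | yes p<a = ⊥-elim (<⇒≱ p<a a≤p)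
... | no _    = refl

mutual
  ∈-shapes⁻ : ∀ ps b {μ} → μ ∈ shapes ps b → Admissible ps μ × firstPart μ ≤ b
  ∈-shapes⁻ []       b       (here refl) = [] , z≤n
  ∈-shapes⁻ (p ∷ ps) (suc b) μ∈ with ∈-++⁻ (shapes (p ∷ ps) b) μ∈
  ... | inj₁ μ∈ˡ = map₂ m≤n⇒m≤1+n (∈-shapes⁻ (p ∷ ps) b μ∈ˡ)
  ... | inj₂ μ∈ʳ = map₂ ≤-reflexive (∈-shapesOfWidth⁻ (p ∷ ps) (suc b) μ∈ʳ)

  ∈-shapesOfWidth⁻ : ∀ ps a {μ} → μ ∈ shapesOfWidth ps a → Admissible ps μ × firstPart μ ≡ a
  ∈-shapesOfWidth⁻ (p ∷ ps) a μ∈ with p <? a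
  ... | yes p<a with ∈-map⁻ (a ∷_) μ∈
  ...   | ρ , ρ∈ , refl = let adm , ρ≤a = ∈-shapes⁻ ps a ρ∈ in (p<a , ρ≤a) ∷ adm , refl

shapesOfWidth⊆shapes : ∀ {p ps a b μ} → a ≤ b →
                       μ ∈ shapesOfWidth (p ∷ ps) a → μ ∈ shapes (p ∷ ps) b
shapesOfWidth⊆shapes {p} {ps} {b = zero} {μ} z≤n μ∈ = subst (μ ∈_) (shapesOfWidth-≤ {p} {ps} z≤n) μ∈
shapesOfWidth⊆shapes {p} {ps} {b = suc b} a≤1+b μ∈ with m≤n⇒m<n∨m≡n a≤1+b
... | inj₁ (s≤s a≤b) = ∈-++⁺ˡ (shapesOfWidth⊆shapes a≤b μ∈)
... | inj₂ refl      = ∈-++⁺ʳ (shapes (p ∷ ps) b) μ∈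

mutual
  ∈-shapes⁺ : ∀ {ps μ b} → Admissible ps μ → firstPart μ ≤ b → μ ∈ shapes ps b
  ∈-shapes⁺ []          _   = here refl
  ∈-shapes⁺ adm@(_ ∷ _) a≤b = shapesOfWidth⊆shapes a≤b (∈-shapesOfWidth⁺ adm)

  ∈-shapesOfWidth⁺ : ∀ {ps a μ} → Admissible ps (a ∷ μ) → (a ∷ μ) ∈ shapesOfWidth ps a
  ∈-shapesOfWidth⁺ {p ∷ ps} {a} ((p<a , μ≤a) ∷ adm) with p <? a
  ... | yes _   = ∈-map⁺ (a ∷_) (∈-shapes⁺ adm μ≤a)
  ... | no p≮a = ⊥-elim (p≮a p<a)

firstPart-shapes : ∀ {ps b μ} → μ ∈ shapes ps b → firstPart μ ≤ b
firstPart-shapes {ps} {b} μ∈ = proj₂ (∈-shapes⁻ ps b μ∈)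

firstPart-shapesOfWidth : ∀ {ps a μ} → μ ∈ shapesOfWidth ps a → firstPart μ ≡ a
firstPart-shapesOfWidth {ps} {a} μ∈ = proj₂ (∈-shapesOfWidth⁻ ps a μ∈)

mutual
  shapes-unique : ∀ ps b → Unique (shapes ps b)
  shapes-unique []       b       = [] ∷ []
  shapes-unique (p ∷ ps) zero    = []
  shapes-unique (p ∷ ps) (suc b) =
    Unique.++⁺ (shapes-unique (p ∷ ps) b) (shapesOfWidth-unique (p ∷ ps) (suc b))
      λ (μ∈ˡ , μ∈ʳ) → 1+n≰n (subst (_≤ b) (firstPart-shapesOfWidth {p ∷ ps} μ∈ʳ)
                                          (firstPart-shapes {p ∷ ps} μ∈ˡ))

  shapesOfWidth-unique : ∀ ps a → Unique (shapesOfWidth ps a)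
  shapesOfWidth-unique []       a = []
  shapesOfWidth-unique (p ∷ ps) a with p <? a
  ... | yes _ = Unique.map⁺ ∷-injectiveʳ (shapes-unique ps a)
  ... | no  _ = []

length-shapesOfWidth-< : ∀ {p ps a} → p < a → length (shapesOfWidth (p ∷ ps) a) ≡ length (shapes ps a)
length-shapesOfWidth-< {ps = ps} {a} p<a =
  trans (cong length (shapesOfWidth-< p<a)) (length-map (a ∷_) (shapes ps a))

length-shapes-suc : ∀ ps b →
  length (shapes ps (suc b)) ≡ length (shapes ps b) + length (shapesOfWidth ps (suc b))
length-shapes-suc []       b = refl
length-shapes-suc (p ∷ ps) b = length-++ (shapes (p ∷ ps) b)

-- A row of length a whose last point is in column p, above a row of length next.
occupiedCorner : ℕ → ℕ → ℕ → ℕ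
occupiedCorner p a next = if does (a ≟ suc p) ∧ does (next <? a) then 1 else 0

occupied : List ℕ → List ℕ → ℕ
occupied (p ∷ ps) (a ∷ μ) = occupiedCorner p a (firstPart μ) + occupied ps μ
occupied _        _       = 0

sum-narrower : ∀ ps b →
  sum (map (λ μ → if does (firstPart μ <? suc b) then 1 else 0) (shapes ps (suc b)))
    ≡ length (shapes ps b)
sum-narrower []       b = refl
sum-narrower (p ∷ ps) b = begin
  sum (map narrower (shapes (p ∷ ps) b ++ shapesOfWidth (p ∷ ps) (suc b)))
    ≡⟨ cong sum (map-++ narrower (shapes (p ∷ ps) b) _) ⟩
  sum (map narrower (shapes (p ∷ ps) b) ++ map narrower (shapesOfWidth (p ∷ ps) (suc b)))
    ≡⟨ sum-++ (map narrower (shapes (p ∷ ps) b)) _ ⟩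
  sum (map narrower (shapes (p ∷ ps) b)) + sum (map narrower (shapesOfWidth (p ∷ ps) (suc b)))
    ≡⟨ cong₂ _+_ (sum-map-constant (shapes (p ∷ ps) b) λ μ∈ →
                    cong (λ x → if x then 1 else 0)
                         (dec-true (_ <? suc b) (s≤s (firstPart-shapes {p ∷ ps} μ∈))))
                 (sum-map-constant (shapesOfWidth (p ∷ ps) (suc b)) λ μ∈ →
                    cong (λ x → if x then 1 else 0)
                         (dec-false (_ <? suc b) (<-irrefl (firstPart-shapesOfWidth {p ∷ ps} μ∈)))) ⟩
  length (shapes (p ∷ ps) b) * 1 + length (shapesOfWidth (p ∷ ps) (suc b)) * 0
    ≡⟨ cong₂ _+_ (*-identityʳ _) (*-zeroʳ (length (shapesOfWidth (p ∷ ps) (suc b)))) ⟩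
  length (shapes (p ∷ ps) b) + 0
    ≡⟨ +-identityʳ _ ⟩
  length (shapes (p ∷ ps) b) ∎
  where
  open ≡-Reasoning
  narrower : List ℕ → ℕ
  narrower μ = if does (firstPart μ <? suc b) then 1 else 0

sum-occupied-∷ : ∀ p ps a (ρs : List (List ℕ)) →
  sum (map (occupied (p ∷ ps)) (map (a ∷_) ρs))
    ≡ sum (map (occupiedCorner p a ∘ firstPart) ρs) + sum (map (occupied ps) ρs)
sum-occupied-∷ p ps a ρs = trans (cong sum (sym (map-∘ ρs))) (sum-map-+ _ (occupied ps) ρs)

module _ (p : ℕ) (ps : List ℕ)
         (ih : ∀ b → sum (map (occupied ps) (shapes ps b)) ≡ length (shapesOfWidth ps b)) where
  open ≡-Reasoning

  private
    occ : List ℕ → ℕ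
    occ = occupied (p ∷ ps)

    corner : ℕ → List ℕ → ℕ
    corner b = occupiedCorner p (suc b) ∘ firstPart

  sum-occupied-shapesOfWidth-< : ∀ {b} → p < suc b →
    sum (map occ (shapesOfWidth (p ∷ ps) (suc b)))
      ≡ sum (map (corner b) (shapes ps (suc b))) + length (shapesOfWidth ps (suc b))
  sum-occupied-shapesOfWidth-< {b} p<1+b = begin
    sum (map occ (shapesOfWidth (p ∷ ps) (suc b)))
      ≡⟨ cong (sum ∘ map occ) (shapesOfWidth-< p<1+b) ⟩
    sum (map occ (map (suc b ∷_) (shapes ps (suc b))))
      ≡⟨ sum-occupied-∷ p ps (suc b) (shapes ps (suc b)) ⟩
    sum (map (corner b) (shapes ps (suc b))) + sum (map (occupied ps) (shapes ps (suc b)))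
      ≡⟨ cong (sum (map (corner b) (shapes ps (suc b))) +_) (ih (suc b)) ⟩
    sum (map (corner b) (shapes ps (suc b))) + length (shapesOfWidth ps (suc b)) ∎

  -- The first row, of length b + 1, can end in an occupied corner only when p = b, and then it does
  -- exactly when the second row is shorter; in that case there are no shapes of width b.
  sum-occupied-widening : ∀ b →
    sum (map occ (shapesOfWidth (p ∷ ps) (suc b))) + length (shapesOfWidth (p ∷ ps) b)
      ≡ length (shapesOfWidth (p ∷ ps) (suc b))
  sum-occupied-widening b with <-cmp p b
  ... | tri< p<b _ _ = begin
    sum (map occ (shapesOfWidth (p ∷ ps) (suc b))) + length (shapesOfWidth (p ∷ ps) b)
      ≡⟨ cong₂ _+_ (sum-occupied-shapesOfWidth-< (m<n⇒m<1+n p<b)) (length-shapesOfWidth-< {p} {ps} p<b) ⟩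
    sum (map (corner b) (shapes ps (suc b))) + length (shapesOfWidth ps (suc b)) + length (shapes ps b)
      ≡⟨ cong (λ x → x + length (shapesOfWidth ps (suc b)) + length (shapes ps b))
              (trans (sum-map-constant (shapes ps (suc b)) λ {ρ} _ → no-corner ρ)
                     (*-zeroʳ (length (shapes ps (suc b))))) ⟩
    length (shapesOfWidth ps (suc b)) + length (shapes ps b)
      ≡⟨ +-comm (length (shapesOfWidth ps (suc b))) _ ⟩
    length (shapes ps b) + length (shapesOfWidth ps (suc b))
      ≡⟨ length-shapes-suc ps b ⟨
    length (shapes ps (suc b))
      ≡⟨ length-shapesOfWidth-< {p} {ps} (m<n⇒m<1+n p<b) ⟨
    length (shapesOfWidth (p ∷ ps) (suc b)) ∎
    where
    no-corner : ∀ ρ → corner b ρ ≡ 0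
    no-corner ρ = cong (λ x → if x ∧ does (firstPart ρ <? suc b) then 1 else 0)
                       (dec-false (suc b ≟ suc p) (<⇒≢ p<b ∘ sym ∘ suc-injective))
  ... | tri≈ _ refl _ = begin
    sum (map occ (shapesOfWidth (p ∷ ps) (suc p))) + length (shapesOfWidth (p ∷ ps) p)
      ≡⟨ cong₂ _+_ (sum-occupied-shapesOfWidth-< ≤-refl) (cong length (shapesOfWidth-≤ {p} {ps} ≤-refl)) ⟩
    sum (map (corner p) (shapes ps (suc p))) + length (shapesOfWidth ps (suc p)) + 0
      ≡⟨ +-identityʳ _ ⟩
    sum (map (corner p) (shapes ps (suc p))) + length (shapesOfWidth ps (suc p))
      ≡⟨ cong (_+ length (shapesOfWidth ps (suc p)))
              (trans (cong sum (map-cong corner-if-shorter (shapes ps (suc p)))) (sum-narrower ps p)) ⟩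
    length (shapes ps p) + length (shapesOfWidth ps (suc p))
      ≡⟨ length-shapes-suc ps p ⟨
    length (shapes ps (suc p))
      ≡⟨ length-shapesOfWidth-< {p} {ps} ≤-refl ⟨
    length (shapesOfWidth (p ∷ ps) (suc p)) ∎
    where
    corner-if-shorter : ∀ ρ → corner p ρ ≡ (if does (firstPart ρ <? suc p) then 1 else 0)
    corner-if-shorter ρ = cong (λ x → if x ∧ does (firstPart ρ <? suc p) then 1 else 0)
                               (dec-true (suc p ≟ suc p) refl)
  ... | tri> _ _ b<p
    rewrite shapesOfWidth-≤ {p} {ps} b<p | shapesOfWidth-≤ {p} {ps} (<⇒≤ b<p) = refl

sum-occupied-shapes : ∀ ps b → sum (map (occupied ps) (shapes ps b)) ≡ length (shapesOfWidth ps b)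
sum-occupied-shapes []       b       = refl
sum-occupied-shapes (p ∷ ps) zero    = refl
sum-occupied-shapes (p ∷ ps) (suc b) = begin
  sum (map occ (shapes (p ∷ ps) b ++ shapesOfWidth (p ∷ ps) (suc b)))
    ≡⟨ cong sum (map-++ occ (shapes (p ∷ ps) b) _) ⟩
  sum (map occ (shapes (p ∷ ps) b) ++ map occ (shapesOfWidth (p ∷ ps) (suc b)))
    ≡⟨ sum-++ (map occ (shapes (p ∷ ps) b)) _ ⟩
  sum (map occ (shapes (p ∷ ps) b)) + sum (map occ (shapesOfWidth (p ∷ ps) (suc b)))
    ≡⟨ cong (_+ sum (map occ (shapesOfWidth (p ∷ ps) (suc b)))) (sum-occupied-shapes (p ∷ ps) b) ⟩
  length (shapesOfWidth (p ∷ ps) b) + sum (map occ (shapesOfWidth (p ∷ ps) (suc b)))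
    ≡⟨ +-comm (length (shapesOfWidth (p ∷ ps) b)) _ ⟩
  sum (map occ (shapesOfWidth (p ∷ ps) (suc b))) + length (shapesOfWidth (p ∷ ps) b)
    ≡⟨ sum-occupied-widening p ps (sum-occupied-shapes ps) b ⟩
  length (shapesOfWidth (p ∷ ps) (suc b)) ∎
  where
  open ≡-Reasoning
  occ : List ℕ → ℕ
  occ = occupied (p ∷ ps)

sum-occupied-shapesOfWidth : ∀ ps b → shapes ps b ≡ [] →
  sum (map (occupied ps) (shapesOfWidth ps (suc b))) ≡ length (shapesOfWidth ps (suc b))
sum-occupied-shapesOfWidth []       b ()
sum-occupied-shapesOfWidth (p ∷ ps) b none =
  subst (λ xs → sum (map occ (xs ++ shapesOfWidth (p ∷ ps) (suc b)))
                   ≡ length (shapesOfWidth (p ∷ ps) (suc b)))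
        none (sum-occupied-shapes (p ∷ ps) (suc b))
  where
  occ : List ℕ → ℕ
  occ = occupied (p ∷ ps)

inRow-length : ∀ r j → inRow r j ≡ does (j <? length r)
inRow-length []      j       = refl
inRow-length (b ∷ r) zero    = refl
inRow-length (b ∷ r) (suc j) = inRow-length r j

inRow⇒< : ∀ r {j} → inRow r j ≡ true → j < length r
inRow⇒< (b ∷ r) {zero}  _  = s≤s z≤n
inRow⇒< (b ∷ r) {suc j} j∈ = s≤s (inRow⇒< r j∈)

<⇒inRow : ∀ r {j} → j < length r → inRow r j ≡ true
<⇒inRow (b ∷ r) {zero}  _         = refl
<⇒inRow (b ∷ r) {suc j} (s≤s j<r) = <⇒inRow r j<r

ptRow-length : ∀ r {j} → ptRow r j ≡ true → j < length r
ptRow-length (b ∷ r) {zero}  _  = s≤s z≤n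
ptRow-length (b ∷ r) {suc j} pt = s≤s (ptRow-length r pt)

ptRow-applyUpTo : ∀ f a j → ptRow (applyUpTo f a) j ≡ (if does (j <? a) then f j else false)
ptRow-applyUpTo f zero    j       = refl
ptRow-applyUpTo f (suc a) zero    = refl
ptRow-applyUpTo f (suc a) (suc j) = ptRow-applyUpTo (f ∘ suc) a j

applyUpTo-ptRow : ∀ r → applyUpTo (ptRow r) (length r) ≡ r
applyUpTo-ptRow []      = refl
applyUpTo-ptRow (b ∷ r) = cong (b ∷_) (applyUpTo-ptRow r)

pt-length : ∀ T {i j} → pt T i j ≡ true → i < length T
pt-length (r ∷ T) {zero}  _  = s≤s z≤n
pt-length (r ∷ T) {suc i} pt = s≤s (pt-length T pt)

young-width : ∀ T → IsYoung T → ∀ i → length (rowAt T i) ≤ width T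
young-width T young zero    = ≤-refl
young-width T young (suc i) = ≤-trans (young i) (young-width T young i)

-- The summand of oc T at cell (i , j), where r and r' are the rows i and i + 1 of T.
cornerCell : List Bool → List Bool → ℕ → ℕ
cornerCell r r' j = if (inRow r j ∧ not (inRow r' j) ∧ not (inRow r (suc j))) ∧ ptRow r j then 1 else 0

lastCellCorner : List Bool → List Bool → ℕ
lastCellCorner r r' = if ptRow r (pred (length r)) ∧ does (length r' <? length r) then 1 else 0

sum-cornerCells : ∀ r r' {W} → length r ≤ W → sum (map (cornerCell r r') (upTo W)) ≡ lastCellCorner r r'
sum-cornerCells []      r' {W} _   =
  trans (cong sum (map-upTo (cornerCell [] r') W)) (sum-applyUpTo-zero _ W λ _ → refl)
sum-cornerCells r@(b ∷ r₁) r' {W} r≤W = begin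
  sum (map (cornerCell r r') (upTo W))   ≡⟨ cong sum (map-upTo (cornerCell r r') W) ⟩
  sum (applyUpTo (cornerCell r r') W)    ≡⟨ sum-applyUpTo-single (cornerCell r r') r≤W elsewhere ⟩
  cornerCell r r' m                      ≡⟨ at-end ⟩
  lastCellCorner r r' ∎
  where
  open ≡-Reasoning
  m : ℕ
  m = length r₁
  elsewhere : ∀ j → j ≢ m → cornerCell r r' j ≡ 0
  elsewhere j j≢m rewrite inRow-length r j | inRow-length r (suc j) with <-cmp j m
  ... | tri< j<m _ _ rewrite dec-true (j <? suc m) (m<n⇒m<1+n j<m) | dec-true (suc j <? suc m) (s≤s j<m)
                           | ∧-zeroʳ (not (inRow r' j)) = refl
  ... | tri≈ _ j≡m _ = ⊥-elim (j≢m j≡m)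
  ... | tri> _ _ m<j rewrite dec-false (j <? suc m) (≤⇒≯ m<j) = refl
  at-end : cornerCell r r' m ≡ lastCellCorner r r'
  at-end rewrite inRow-length r m | inRow-length r (suc m) | inRow-length r' m
               | dec-true (m <? suc m) ≤-refl | dec-false (suc m <? suc m) (<-irrefl refl)
               | not-<? m (length r') | ∧-identityʳ (does (length r' <? suc m))
               = cong (λ x → if x then 1 else 0) (∧-comm (does (length r' <? suc m)) (ptRow r m))

occupiedCorners : Tableau → ℕ
occupiedCorners []       = 0
occupiedCorners (r ∷ rs) = lastCellCorner r (rowAt rs 0) + occupiedCorners rs

oc-occupiedCorners : ∀ T → IsYoung T → oc T ≡ occupiedCorners T
oc-occupiedCorners T young =
  trans (cong sum (map-upTo _ (length T))) (sum-rows T (young-width T young))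
  where
  sum-rows : ∀ {W} T → (∀ i → length (rowAt T i) ≤ W) →
    sum (applyUpTo (λ i → sum (map (cornerCell (rowAt T i) (rowAt T (suc i))) (upTo W))) (length T))
      ≡ occupiedCorners T
  sum-rows []       _   = refl
  sum-rows (r ∷ rs) r≤W = cong₂ _+_ (sum-cornerCells r (rowAt rs 0) (r≤W 0)) (sum-rows rs (r≤W ∘ suc))

-- 0 for a row without points.
lastPoint : List Bool → ℕ
lastPoint []      = 0
lastPoint (b ∷ r) = if or r then suc (lastPoint r) else 0

ptRow-or : ∀ r {j} → ptRow r j ≡ true → or r ≡ true
ptRow-or (true ∷ r) {zero}  _  = refl
ptRow-or (b    ∷ r) {suc j} pt = trans (cong (b ∨_) (ptRow-or r pt)) (∨-zeroʳ b)

point≤lastPoint : ∀ r {j} → ptRow r j ≡ true → j ≤ lastPoint r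
point≤lastPoint (b ∷ r) {zero}  _  = z≤n
point≤lastPoint (b ∷ r) {suc j} pt rewrite ptRow-or r pt = s≤s (point≤lastPoint r pt)

ptRow-lastPoint : ∀ r {j} → ptRow r j ≡ true → ptRow r (lastPoint r) ≡ true
ptRow-lastPoint r pt = lastPoint-point r (ptRow-or r pt)
  where
  lastPoint-point : ∀ r → or r ≡ true → ptRow r (lastPoint r) ≡ true
  lastPoint-point (b ∷ r) b∨r with or r in r-has-point
  ... | true  = lastPoint-point r r-has-point
  ... | false = trans (sym (∨-identityʳ b)) b∨r

ptRow-beyond-lastPoint : ∀ r {j} → lastPoint r < j → ptRow r j ≡ false
ptRow-beyond-lastPoint r lp<j = ¬-not λ pt → <⇒≱ lp<j (point≤lastPoint r pt)

ptRow-from-lastPoint : ∀ r {j a} → ptRow r j ≡ true → lastPoint r ≤ a →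
                       ptRow r a ≡ does (a ≟ lastPoint r)
ptRow-from-lastPoint r pt lp≤a with m≤n⇒m<n∨m≡n lp≤a
... | inj₁ lp<a = trans (ptRow-beyond-lastPoint r lp<a) (sym (dec-false (_ ≟ _) (>⇒≢ lp<a)))
... | inj₂ refl = trans (ptRow-lastPoint r pt) (sym (dec-true (lastPoint r ≟ lastPoint r) refl))

-- Filling a shape with the points of a tableau

padRow : List Bool → ℕ → List Bool
padRow r a = applyUpTo (ptRow r) a

-- T₀ is padded with empty rows, so that map length ∘ fill T₀ is the identity.
fill : Tableau → List ℕ → Tableau
fill _        []      = []
fill []       (a ∷ μ) = padRow [] a ∷ fill [] μ
fill (r ∷ rs) (a ∷ μ) = padRow r a ∷ fill rs μ

lastPoints : Tableau → List ℕ
lastPoints = map lastPoint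

HasNoEmptyRow : Tableau → Set
HasNoEmptyRow T = ∀ i → i < length T → ∃ λ j → pt T i j ≡ true

ptRow-padRow : ∀ r {a} → lastPoint r < a → ∀ j → ptRow (padRow r a) j ≡ ptRow r j
ptRow-padRow r {a} lp<a j = trans (ptRow-applyUpTo (ptRow r) a j) (inside-or-beyond (j <? a))
  where
  inside-or-beyond : (j<?a : Dec (j < a)) → (if does j<?a then ptRow r j else false) ≡ ptRow r j
  inside-or-beyond (yes _)   = refl
  inside-or-beyond (no j≮a) = sym (ptRow-beyond-lastPoint r (<-≤-trans lp<a (≮⇒≥ j≮a)))

lastCellCorner-padRow : ∀ r r' {j a} → ptRow r j ≡ true → lastPoint r < a →
  lastCellCorner (padRow r a) r' ≡ occupiedCorner (lastPoint r) a (length r')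
lastCellCorner-padRow r r' {a = suc a} pt lp<1+a =
  trans (cong (λ n → if ptRow (padRow r (suc a)) (pred n) ∧ does (length r' <? n) then 1 else 0)
              (length-applyUpTo (ptRow r) (suc a)))
        (cong (λ x → if x ∧ does (length r' <? suc a) then 1 else 0)
              (trans (ptRow-padRow r lp<1+a a) (ptRow-from-lastPoint r pt (s≤s⁻¹ lp<1+a))))

lengths-fill : ∀ T₀ μ → map length (fill T₀ μ) ≡ μ
lengths-fill _        []      = refl
lengths-fill []       (a ∷ μ) = cong₂ _∷_ (length-applyUpTo _ a) (lengths-fill [] μ)
lengths-fill (r ∷ rs) (a ∷ μ) = cong₂ _∷_ (length-applyUpTo _ a) (lengths-fill rs μ)

fill-injective : ∀ T₀ {μ ν} → fill T₀ μ ≡ fill T₀ ν → μ ≡ ν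
fill-injective T₀ {μ} {ν} eq =
  trans (sym (lengths-fill T₀ μ)) (trans (cong (map length) eq) (lengths-fill T₀ ν))

width-fill : ∀ T₀ μ → width (fill T₀ μ) ≡ firstPart μ
width-fill _        []      = refl
width-fill []       (a ∷ μ) = length-applyUpTo _ a
width-fill (r ∷ rs) (a ∷ μ) = length-applyUpTo _ a

length-fill : ∀ {T₀ μ} → Admissible (lastPoints T₀) μ → length (fill T₀ μ) ≡ length T₀
length-fill {[]}     []        = refl
length-fill {r ∷ rs} (_ ∷ adm) = cong suc (length-fill adm)

samePoints-fill : ∀ {T₀ μ} → Admissible (lastPoints T₀) μ → SamePoints (fill T₀ μ) T₀
samePoints-fill {[]}     []                  i       j = refl
samePoints-fill {r ∷ rs} ((lp<a , _) ∷ adm) zero    j = ptRow-padRow r lp<a j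
samePoints-fill {r ∷ rs} (_          ∷ adm) (suc i) j = samePoints-fill adm i j

young-fill : ∀ {T₀ μ} → Admissible (lastPoints T₀) μ → IsYoung (fill T₀ μ)
young-fill {[]}             []                  i       = z≤n
young-fill {r ∷ rs} {a ∷ μ} ((_ , μ≤a) ∷ adm) zero    =
  subst₂ _≤_ (sym (width-fill rs μ)) (sym (length-applyUpTo (ptRow r) a)) μ≤a
young-fill {r ∷ rs} {a ∷ μ} (_          ∷ adm) (suc i) = young-fill adm i

occupiedCorners-fill : ∀ {T₀ μ} → HasNoEmptyRow T₀ → Admissible (lastPoints T₀) μ →
                       occupiedCorners (fill T₀ μ) ≡ occupied (lastPoints T₀) μ
occupiedCorners-fill {[]}             _       []                 = refl
occupiedCorners-fill {r ∷ rs} {a ∷ μ} noEmpty ((lp<a , _) ∷ adm) =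
  cong₂ _+_ (trans (lastCellCorner-padRow r (rowAt (fill rs μ) 0) (proj₂ (noEmpty 0 (s≤s z≤n))) lp<a)
                   (cong (occupiedCorner (lastPoint r) a) (width-fill rs μ)))
            (occupiedCorners-fill (λ i i< → noEmpty (suc i) (s≤s i<)) adm)

firstPart-lengths : ∀ T → firstPart (map length T) ≡ width T
firstPart-lengths []      = refl
firstPart-lengths (r ∷ _) = refl

fill-lengths : ∀ {T T₀} → length T ≡ length T₀ → SamePoints T T₀ → fill T₀ (map length T) ≡ T
fill-lengths {[]}     {[]}       _  _  = refl
fill-lengths {r ∷ rs} {r₀ ∷ rs₀} eq sp =
  cong₂ _∷_ (trans (applyUpTo-cong (length r) (sym ∘ sp 0)) (applyUpTo-ptRow r))
            (fill-lengths (suc-injective eq) (sp ∘ suc))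

admissible-lengths : ∀ {T T₀} → length T ≡ length T₀ → IsYoung T → SamePoints T T₀ →
                     HasNoEmptyRow T₀ → Admissible (lastPoints T₀) (map length T)
admissible-lengths {[]}     {[]}       _  _     _  _       = []
admissible-lengths {r ∷ rs} {r₀ ∷ rs₀} eq young sp noEmpty =
  (lastPoint<length , subst (_≤ length r) (sym (firstPart-lengths rs)) (young 0))
  ∷ admissible-lengths (suc-injective eq) (young ∘ suc) (sp ∘ suc) (λ i i< → noEmpty (suc i) (s≤s i<))
  where
  lastPoint<length : lastPoint r₀ < length r
  lastPoint<length = let _ , pt = noEmpty 0 (s≤s z≤n) in
    ptRow-length r (trans (sp 0 (lastPoint r₀)) (ptRow-lastPoint r₀ pt))

length-≤ : ∀ {T T'} → HasNoEmptyRow T → SamePoints T T' → length T ≤ length T'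
length-≤ {T} {T'} noEmpty sp with length T
... | zero  = z≤n
... | suc n = let j , pt = noEmpty n ≤-refl in pt-length T' (trans (sym (sp n j)) pt)

width-≤ : ∀ {T T'} → (∀ j → inD T 0 j ≡ true → ∃ λ i → pt T i j ≡ true) → IsYoung T' →
          SamePoints T T' → width T ≤ width T'
width-≤ {T} {T'} noEmptyCol young' sp with width T in eq
... | zero  = z≤n
... | suc n = let i , pt = noEmptyCol n (<⇒inRow (rowAt T 0) (subst (n <_) (sym eq) ≤-refl)) in
  ≤-trans (ptRow-length (rowAt T' i) (trans (sym (sp i n)) pt)) (young-width T' young' i)

samePoints-length : ∀ {T T'} → TreeLike T → TreeLike T' → SamePoints T T' → length T ≡ length T'
samePoints-length {T} {T'} tl tl' sp =
  ≤-antisym (length-≤ {T} {T'} (TreeLike.noEmptyRow tl) sp)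
            (length-≤ {T'} {T} (TreeLike.noEmptyRow tl') (λ i j → sym (sp i j)))

samePoints-width : ∀ {T T'} → TreeLike T → TreeLike T' → SamePoints T T' → width T ≡ width T'
samePoints-width {T} {T'} tl tl' sp =
  ≤-antisym (width-≤ {T} {T'} (TreeLike.noEmptyCol tl) (TreeLike.young tl') sp)
            (width-≤ {T'} {T} (TreeLike.noEmptyCol tl') (TreeLike.young tl) (λ i j → sym (sp i j)))

treeLike-samePoints : ∀ {T T₀} → TreeLike T₀ → IsYoung T →
                      length T ≤ length T₀ → width T ≤ width T₀ → SamePoints T T₀ → TreeLike T
treeLike-samePoints {T} {T₀} tl₀ young rows≤ width≤ sp = record
  { young      = young
  ; topLeft    = trans (sp 0 0) topLeft₀
  ; treeRule   = λ i j pt not-origin →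
      let one , not-both = treeRule₀ i j (trans (sym (sp i j)) pt) not-origin
      in Sum.map above₀ left₀ one , λ (a , l) → not-both (above a , left l)
  ; noEmptyRow = λ i i< → let j , pt = noEmptyRow₀ i (<-≤-trans i< rows≤) in j , trans (sp i j) pt
  ; noEmptyCol = λ j j∈ →
      let i , pt = noEmptyCol₀ j (<⇒inRow (rowAt T₀ 0) (<-≤-trans (inRow⇒< (rowAt T 0) j∈) width≤))
      in i , trans (sp i j) pt
  }
  where
  open TreeLike tl₀ using () renaming (topLeft to topLeft₀; treeRule to treeRule₀;
                                      noEmptyRow to noEmptyRow₀; noEmptyCol to noEmptyCol₀)
  above₀ : ∀ {i j} → PointAbove T₀ i j → PointAbove T i j
  above₀ (i' , i'<i , pt) = i' , i'<i , trans (sp i' _) pt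
  left₀ : ∀ {i j} → PointLeft T₀ i j → PointLeft T i j
  left₀ (j' , j'<j , pt) = j' , j'<j , trans (sp _ j') pt
  above : ∀ {i j} → PointAbove T i j → PointAbove T₀ i j
  above (i' , i'<i , pt) = i' , i'<i , trans (sym (sp i' _)) pt
  left : ∀ {i j} → PointLeft T i j → PointLeft T₀ i j
  left (j' , j'<j , pt) = j' , j'<j , trans (sym (sp _ j')) pt

-- The class of a tree-like tableau

module Class {T₀ : Tableau} (tl₀ : TreeLike T₀) where
  open TreeLike tl₀

  shapesOfClass : List (List ℕ)
  shapesOfClass = shapesOfWidth (lastPoints T₀) (width T₀)

  fill-inClass : ∀ {μ} → μ ∈ shapesOfClass → TreeLike (fill T₀ μ) × SamePoints (fill T₀ μ) T₀
  fill-inClass {μ} μ∈ =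
    treeLike-samePoints tl₀ (young-fill adm) (≤-reflexive (length-fill adm))
                        (≤-reflexive (trans (width-fill T₀ μ) μ-width)) (samePoints-fill adm)
    , samePoints-fill adm
    where
    adm : Admissible (lastPoints T₀) μ
    adm = proj₁ (∈-shapesOfWidth⁻ (lastPoints T₀) (width T₀) μ∈)
    μ-width : firstPart μ ≡ width T₀
    μ-width = proj₂ (∈-shapesOfWidth⁻ (lastPoints T₀) (width T₀) μ∈)

  lengths-inClass : ∀ {T} → TreeLike T → SamePoints T T₀ → map length T ∈ shapesOfClass
  lengths-inClass {[]}     tl sp with () ← TreeLike.topLeft tl
  lengths-inClass {r ∷ rs} tl sp =
    subst (λ w → map length (r ∷ rs) ∈ shapesOfWidth (lastPoints T₀) w) (samePoints-width tl tl₀ sp)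
          (∈-shapesOfWidth⁺ (admissible-lengths {r ∷ rs} {T₀} (samePoints-length tl tl₀ sp)
                                                (TreeLike.young tl) sp noEmptyRow))

  class-↭ : ∀ {C} → Unique C → (∀ T → (T ∈ C) ⇔ (TreeLike T × SamePoints T T₀)) →
            C ↭ map (fill T₀) shapesOfClass
  class-↭ {C} unique C⇔ = ∼bag⇒↭ (unique∧set⇒bag unique fills-unique (mk⇔ to from))
    where
    fills-unique : Unique (map (fill T₀) shapesOfClass)
    fills-unique = Unique.map⁺ (fill-injective T₀) (shapesOfWidth-unique (lastPoints T₀) (width T₀))
    to : ∀ {T} → T ∈ C → T ∈ map (fill T₀) shapesOfClass
    to {T} T∈C = let tl , sp = Equivalence.to (C⇔ T) T∈C in
      subst (_∈ map (fill T₀) shapesOfClass) (fill-lengths (samePoints-length tl tl₀ sp) sp)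
            (∈-map⁺ (fill T₀) (lengths-inClass tl sp))
    from : ∀ {T} → T ∈ map (fill T₀) shapesOfClass → T ∈ C
    from T∈ with ∈-map⁻ (fill T₀) T∈
    ... | μ , μ∈ , refl = Equivalence.from (C⇔ _) (fill-inClass μ∈)

  -- Column c of T₀ contains a point, which would lie outside a filled shape of width at most c.
  narrower-shapes-absent : ∀ {c} → suc c ≡ width T₀ → shapes (lastPoints T₀) c ≡ []
  narrower-shapes-absent {c} 1+c≡w = all∉⇒≡[] λ {μ} μ∈ →
    let adm , μ≤c = ∈-shapes⁻ (lastPoints T₀) c μ∈
        i , pt₀   = noEmptyCol c (<⇒inRow (rowAt T₀ 0) (≤-reflexive 1+c≡w))
        pt        = trans (samePoints-fill {T₀} adm i c) pt₀
    in <⇒≱ (≤-trans (ptRow-length (rowAt (fill T₀ μ) i) pt)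
                    (young-width (fill T₀ μ) (young-fill {T₀} adm) i))
           (subst (_≤ c) (sym (width-fill T₀ μ)) μ≤c)

  sum-occupied-class : ∀ {w} → w ≡ width T₀ →
    sum (map (occupied (lastPoints T₀)) (shapesOfWidth (lastPoints T₀) w))
      ≡ length (shapesOfWidth (lastPoints T₀) w)
  sum-occupied-class {zero}  0≡w   = ⊥-elim (<⇒≢ (ptRow-length (rowAt T₀ 0) topLeft) 0≡w)
  sum-occupied-class {suc c} 1+c≡w =
    sum-occupied-shapesOfWidth (lastPoints T₀) c (narrower-shapes-absent 1+c≡w)

  sum-oc-class : sum (map oc (map (fill T₀) shapesOfClass)) ≡ length shapesOfClass
  sum-oc-class = begin
    sum (map oc (map (fill T₀) shapesOfClass))          ≡⟨ cong sum (map-∘ shapesOfClass) ⟨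
    sum (map (oc ∘ fill T₀) shapesOfClass)              ≡⟨ cong sum (map-cong-local (All.tabulate oc-fill)) ⟩
    sum (map (occupied (lastPoints T₀)) shapesOfClass)  ≡⟨ sum-occupied-class refl ⟩
    length shapesOfClass                                ∎
    where
    open ≡-Reasoning
    oc-fill : ∀ {μ} → μ ∈ shapesOfClass → oc (fill T₀ μ) ≡ occupied (lastPoints T₀) μ
    oc-fill {μ} μ∈ = let adm = proj₁ (∈-shapesOfWidth⁻ (lastPoints T₀) (width T₀) μ∈) in
      trans (oc-occupiedCorners (fill T₀ μ) (young-fill {T₀} adm)) (occupiedCorners-fill noEmptyRow adm)

theorem3p8 : (C : List Tableau) → IsNonAmbiguousClass C →
    sum (map oc C) ≡ length C
theorem3p8 C (unique , T₀ , tl₀ , C⇔) = begin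
  sum (map oc C)                              ≡⟨ sum-↭ (↭.map⁺ oc C↭) ⟩
  sum (map oc (map (fill T₀) shapesOfClass))  ≡⟨ sum-oc-class ⟩
  length shapesOfClass                        ≡⟨ length-map (fill T₀) shapesOfClass ⟨
  length (map (fill T₀) shapesOfClass)        ≡⟨ ↭.↭-length C↭ ⟨
  length C                                    ∎
  where
  open ≡-Reasoning
  open Class tl₀
  C↭ : C ↭ map (fill T₀) shapesOfClass
  C↭ = class-↭ unique C⇔
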